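{- Let $n$ be an even integer and let $G$ be a $3$-partite graph on $n$ vertices. Then there exists a partition $V(G)=A\cup B$ with $|A|=|B|=n/2$ such that $e(A)+e(B)\leq n^2/9$.
   Context: A graph is $3$-partite if its vertex set can be partitioned into three independent sets. For $S\subseteq V(G)$, $e(S)$ denotes the number of edges of $G$ with both endpoints in $S$. -}

module Defs where

open import Data.Nat using (ℕ; zero; suc; _+_; _*_; _<_; _<?_)
open import Data.Product using (Σ)
open import Data.Bool using (Bool; true; false; _∧_; if_then_else_)
open import Data.Fin using (Fin; toℕ) renaming (zero to fzero; suc to fsuc)
open import Relation.Binary.PropositionalEquality using (_≡_; _≢_)
open import Relation.Nullary using (does)

∑ : (n : ℕ) → (Fin n → ℕ) → ℕ
∑ zero    f = 0
∑ (suc n) f = f fzero + ∑ n (λ i → f (fsuc i))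

record Graph (n : ℕ) : Set where
  field
    Adj     : Fin n → Fin n → Bool
    symm    : ∀ i j → Adj i j ≡ Adj j i
    irrefl  : ∀ i → Adj i i ≡ false
open Graph public

ThreePartite : ∀ {n} → Graph n → Set
ThreePartite {n} G =
  Σ (Fin n → Fin 3) λ c → ∀ i j → Adj G i j ≡ true → c i ≢ c j

⟦_⟧ : Bool → ℕ
⟦ true  ⟧ = 1
⟦ false ⟧ = 0

sizeTrue : ∀ {n} → (Fin n → Bool) → ℕ
sizeTrue {n} side = ∑ n (λ i → ⟦ side i ⟧)

_==_ : Bool → Bool → Bool
true  == b = b
false == true  = false
false == false = true

-- e(A) + e(B) for the partition A = side⁻¹(true), B = side⁻¹(false):
-- the number of edges {i,j} (counted once, with toℕ i < toℕ j) whose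
-- endpoints lie on the same side.
inducedEdges : ∀ {n} → Graph n → (Fin n → Bool) → ℕ
inducedEdges {n} G side =
  ∑ n (λ i → ∑ n (λ j →
    ⟦ does (toℕ i <? toℕ j) ∧ (Adj G i j ∧ (side i == side j)) ⟧))

-- Let a, b, c be the sizes of the colour classes. An edge inside a side joins two
-- differently coloured vertices of that side, so if x_k (resp. y_k) vertices of class k
-- are put on side A (resp. B), then e(A) + e(B) ≤ e₂(x) + e₂(y), with e₂ the second
-- elementary symmetric polynomial. It remains to choose x + y = (a, b, c) with
-- x_a + x_b + x_c = m = n/2 and 9 (e₂(x) + e₂(y)) ≤ n². Order the classes so that
-- a ≥ b ≥ c. If a ≥ m, let A consist of m vertices of the largest class; then
-- 9 e₂(y) ≤ n² because e₂(y) ≤ 2 Σ y_k². Otherwise put the largest class into A, the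
-- middle one into B, and split the smallest one to balance the sides; the bound is then
-- a polynomial identity with a remainder having nonnegative coefficients.
module Submission where

open import Defs
open import Data.Bool using (Bool; true; false; not; _∧_)
open import Data.Fin using (Fin; zero; suc; toℕ)
open import Data.Fin.Patterns using (0F; 1F; 2F)
open import Data.Fin.Properties using (_≟_)
open import Data.Nat hiding (_≟_)
open import Data.Nat.Properties hiding (_≟_)
open import Data.Nat.Tactic.RingSolver using (solve-∀)
open import Data.Product using (Σ; _×_; _,_; proj₁; proj₂; map₂)
open import Data.Sum using (inj₁; inj₂)
open import Data.Vec using (_∷_; []; lookup)
open import Data.Vec.Functional using (updateAt)
open import Data.Vec.Functional.Properties using (updateAt-updates; updateAt-minimal)
open import Function using (_∘_)
open import Relation.Binary.PropositionalEquality
open import Relation.Nullary using (does; yes; no)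
open import Relation.Nullary.Decidable using (dec-true; dec-false)
open import Algebra.Properties.CommutativeSemigroup +-commutativeSemigroup
  using (xy∙z≈yx∙z; xy∙z≈xz∙y)
open import Algebra.Properties.Semiring.Sum +-*-semiring
  using (sum; sum-cong-≗; ∑-distrib-+; ∑-comm; sum-replicate-zero; *-distribʳ-sum)

-- The numerical lemma

e₂ : ℕ → ℕ → ℕ → ℕ
e₂ x y z = x * y + x * z + y * z

-- solve-∀ does not unfold definitions, so identities involving e₂ or sums are proved
-- by instantiating their expanded form.
e₂-comm₁₂ : ∀ x y z → e₂ x y z ≡ e₂ y x z
e₂-comm₁₂ = expanded
  where
  expanded : ∀ x y z → x * y + x * z + y * z ≡ y * x + y * z + x * z
  expanded = solve-∀

e₂-comm₂₃ : ∀ x y z → e₂ x y z ≡ e₂ x z y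
e₂-comm₂₃ = expanded
  where
  expanded : ∀ x y z → x * y + x * z + y * z ≡ x * z + x * y + z * y
  expanded = solve-∀

m*n≤m*m+n*n : ∀ x y → x * y ≤ x * x + y * y
m*n≤m*m+n*n x y with ≤-total x y
... | inj₁ x≤y = ≤-trans (*-monoˡ-≤ y x≤y) (m≤n+m (y * y) (x * x))
... | inj₂ y≤x = ≤-trans (*-monoʳ-≤ x y≤x) (m≤m+n (x * x) (y * y))

e₂≤2*squares : ∀ x y z → e₂ x y z ≤ 2 * (x * x + y * y + z * z)
e₂≤2*squares x y z = subst (e₂ x y z ≤_) (regroup x y z)
  (+-mono-≤ (+-mono-≤ (m*n≤m*m+n*n x y) (m*n≤m*m+n*n x z)) (m*n≤m*m+n*n y z))
  where
  regroup : ∀ x y z → x * x + y * y + (x * x + z * z) + (y * y + z * z) ≡ 2 * (x * x + y * y + z * z)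
  regroup = solve-∀

-- x· and y· count the vertices of the classes of sizes a, b, c put on side A and on side B.
record BalancedSplit (m a b c : ℕ) : Set where
  constructor balanced
  field
    xa ya xb yb xc yc : ℕ
    a-split : xa + ya ≡ a
    b-split : xb + yb ≡ b
    c-split : xc + yc ≡ c
    half    : xa + xb + xc ≡ m
    bound   : 9 * (e₂ xa xb xc + e₂ ya yb yc) ≤ (m + m) * (m + m)

module _ {m a b c : ℕ} (split : BalancedSplit m a b c) where
  open BalancedSplit split

  swap₁₂ : BalancedSplit m b a c
  swap₁₂ = balanced xb yb xa ya xc yc b-split a-split c-split
    (trans (xy∙z≈yx∙z xb xa xc) half)
    (subst (λ t → 9 * t ≤ (m + m) * (m + m))
      (cong₂ _+_ (e₂-comm₁₂ xa xb xc) (e₂-comm₁₂ ya yb yc)) bound)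

  swap₂₃ : BalancedSplit m a c b
  swap₂₃ = balanced xa ya xc yc xb yb a-split c-split b-split
    (trans (xy∙z≈xz∙y xa xc xb) half)
    (subst (λ t → 9 * t ≤ (m + m) * (m + m))
      (cong₂ _+_ (e₂-comm₂₃ xa xb xc) (e₂-comm₂₃ ya yb yc)) bound)

≤-by-excess : ∀ {x y} k → y ≡ x + k → x ≤ y
≤-by-excess {x} k y≡x+k = subst (x ≤_) (sym y≡x+k) (m≤m+n x k)

large-class-split : ∀ t b c → BalancedSplit (t + b + c) (t + b + c + t) b c
large-class-split t b c = balanced (t + b + c) t 0 b 0 c refl refl refl
  (trans (+-identityʳ _) (+-identityʳ _))
  (begin
    9 * (e₂ (t + b + c) 0 0 + e₂ t b c)      ≡⟨ lhs t b c ⟩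
    8 * e₂ t b c + e₂ t b c                  ≤⟨ +-monoʳ-≤ (8 * e₂ t b c) (≤-trans (e₂≤2*squares t b c) (m≤m+n _ _)) ⟩
    8 * e₂ t b c + (2 * S + 2 * S)           ≡⟨ rhs t b c ⟨
    (t + b + c + (t + b + c)) * (t + b + c + (t + b + c)) ∎)
  where
  open ≤-Reasoning
  S = t * t + b * b + c * c
  lhs : ∀ t b c → 9 * ((t + b + c) * 0 + (t + b + c) * 0 + 0 * 0 + (t * b + t * c + b * c))
                ≡ 8 * (t * b + t * c + b * c) + (t * b + t * c + b * c)
  lhs = solve-∀
  rhs : ∀ t b c → (t + b + c + (t + b + c)) * (t + b + c + (t + b + c))
                ≡ 8 * (t * b + t * c + b * c) + (2 * (t * t + b * b + c * c) + 2 * (t * t + b * b + c * c))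
  rhs = solve-∀

-- The case c ≤ b ≤ a ≤ m, with a = m ∸ p, b = a ∸ r, c = b ∸ s: then a + b + c = 2m
-- forces c = 2p + r.
small-classes-split : ∀ p r s →
  BalancedSplit (2 * p + r + s + r + p) (2 * p + r + s + r) (2 * p + r + s) (2 * p + r)
small-classes-split p r s = balanced (2 * p + r + s + r) 0 0 (2 * p + r + s) p (p + r)
  (+-identityʳ _) refl (double p r) (cong (_+ p) (+-identityʳ _))
  (≤-by-excess (7 * r * r + 4 * s * s + 3 * p * r + 6 * p * s + 7 * r * s) (excess p r s))
  where
  double : ∀ p r → p + (p + r) ≡ 2 * p + r
  double = solve-∀
  excess : ∀ p r s →
    (2 * p + r + s + r + p + (2 * p + r + s + r + p)) * (2 * p + r + s + r + p + (2 * p + r + s + r + p))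
    ≡ 9 * ((2 * p + r + s + r) * 0 + (2 * p + r + s + r) * p + 0 * p + (0 * (2 * p + r + s) + 0 * (p + r) + (2 * p + r + s) * (p + r)))
      + (7 * r * r + 4 * s * s + 3 * p * r + 6 * p * s + 7 * r * s)
  excess = solve-∀

split-when-large : ∀ {m a b c} → m ≤ a → a + b + c ≡ m + m → BalancedSplit m a b c
split-when-large {m} {b = b} {c} m≤a sum with m≤n⇒∃[o]m+o≡n m≤a
... | t , refl with +-cancelˡ-≡ m (t + b + c) m (trans (reassoc m t b c) sum)
  where
  reassoc : ∀ m t b c → m + (t + b + c) ≡ m + t + b + c
  reassoc = solve-∀
... | refl = large-class-split t b c

split-when-sorted : ∀ {m a b c} → c ≤ b → b ≤ a → a ≤ m → a + b + c ≡ m + m → BalancedSplit m a b c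
split-when-sorted {c = c} c≤b b≤a a≤m sum
  with m≤n⇒∃[o]m+o≡n c≤b | m≤n⇒∃[o]m+o≡n b≤a | m≤n⇒∃[o]m+o≡n a≤m
... | s , refl | r , refl | p , refl with smallest p r s sum
  where
  smallest : ∀ p r s → c + s + r + (c + s) + c ≡ c + s + r + p + (c + s + r + p) → c ≡ 2 * p + r
  smallest p r s eq = +-cancelˡ-≡ (2 * c + 2 * s + r) c (2 * p + r)
    (trans (lhs c s r) (trans eq (rhs c s r p)))
    where
    lhs : ∀ c s r → 2 * c + 2 * s + r + c ≡ c + s + r + (c + s) + c
    lhs = solve-∀
    rhs : ∀ c s r p → c + s + r + p + (c + s + r + p) ≡ 2 * c + 2 * s + r + (2 * p + r)
    rhs = solve-∀
... | refl = small-classes-split p r s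

split-when-max₁ : ∀ {m a b c} → b ≤ a → c ≤ a → a + b + c ≡ m + m → BalancedSplit m a b c
split-when-max₁ {m} {a} {b} {c} b≤a c≤a sum with ≤-total m a | ≤-total c b
... | inj₁ m≤a | _         = split-when-large m≤a sum
... | inj₂ a≤m | inj₁ c≤b = split-when-sorted c≤b b≤a a≤m sum
... | inj₂ a≤m | inj₂ b≤c = swap₂₃ (split-when-sorted b≤c c≤a a≤m (trans (xy∙z≈xz∙y a c b) sum))

split-when-max₃ : ∀ {m a b c} → a ≤ c → b ≤ c → a + b + c ≡ m + m → BalancedSplit m a b c
split-when-max₃ {a = a} {b} {c} a≤c b≤c sum =
  swap₂₃ (swap₁₂ (split-when-max₁ a≤c b≤c (trans (rotate c a b) sum)))
  where
  rotate : ∀ c a b → c + a + b ≡ a + b + c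
  rotate = solve-∀

balancedSplit : ∀ {m a b c} → a + b + c ≡ m + m → BalancedSplit m a b c
balancedSplit {a = a} {b} {c} sum with ≤-total b a | ≤-total c a | ≤-total c b
... | inj₁ b≤a | inj₁ c≤a | _         = split-when-max₁ b≤a c≤a sum
... | inj₁ b≤a | inj₂ a≤c | _         = split-when-max₃ a≤c (≤-trans b≤a a≤c) sum
... | inj₂ a≤b | _         | inj₁ c≤b = swap₁₂ (split-when-max₁ a≤b c≤b (trans (xy∙z≈yx∙z b a c) sum))
... | inj₂ a≤b | _         | inj₂ b≤c = split-when-max₃ (≤-trans a≤b b≤c) b≤c sum

-- Counting vertices by colour and side

∑≡sum : ∀ n (f : Fin n → ℕ) → ∑ n f ≡ sum f
∑≡sum zero    f = refl
∑≡sum (suc n) f = cong (f zero +_) (∑≡sum n (f ∘ suc))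

∑²≡sum² : ∀ n (f : Fin n → Fin n → ℕ) → ∑ n (λ i → ∑ n (f i)) ≡ sum (λ i → sum (f i))
∑²≡sum² n f = trans (∑≡sum n (λ i → ∑ n (f i))) (sum-cong-≗ λ i → ∑≡sum n (f i))

sum-mono-≤ : ∀ {n} {f g : Fin n → ℕ} → (∀ i → f i ≤ g i) → sum f ≤ sum g
sum-mono-≤ {zero}  f≤g = z≤n
sum-mono-≤ {suc n} f≤g = +-mono-≤ (f≤g zero) (sum-mono-≤ (f≤g ∘ suc))

sum-ones : ∀ n → sum {n} (λ _ → 1) ≡ n
sum-ones zero    = refl
sum-ones (suc n) = cong suc (sum-ones n)

sum³ : (x : Fin 3 → ℕ) → sum x ≡ x 0F + x 1F + x 2F
sum³ x = reassoc (x 0F) (x 1F) (x 2F)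
  where
  reassoc : ∀ a b c → a + (b + (c + 0)) ≡ a + b + c
  reassoc = solve-∀

sum-δ : ∀ {q} (x : Fin q) (h : Fin q → ℕ) → sum (λ k → ⟦ does (x ≟ k) ⟧ * h k) ≡ h x
sum-δ {suc q} zero    h =
  trans (cong₂ _+_ (+-identityʳ (h zero)) (sum-replicate-zero q)) (+-identityʳ (h zero))
sum-δ {suc q} (suc x) h = sum-δ x (h ∘ suc)

sumBool : (Bool → ℕ) → ℕ
sumBool h = h true + h false

sumBool-δ : ∀ d b (h : Bool → ℕ) → sumBool (λ s → ⟦ d ∧ (b == s) ⟧ * h s) ≡ ⟦ d ⟧ * h b
sumBool-δ false b     h = refl
sumBool-δ true  true  h = +-identityʳ (h true + 0)
sumBool-δ true  false h = refl

module _ {n q : ℕ} (colour : Fin n → Fin q) where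

  classSize : Fin q → ℕ
  classSize k = sum (λ i → ⟦ does (colour i ≟ k) ⟧)

  count : (Fin n → Bool) → Fin q → Bool → ℕ
  count side k s = sum (λ i → ⟦ does (colour i ≟ k) ∧ (side i == s) ⟧)

  count-true+false : ∀ side k → count side k true + count side k false ≡ classSize k
  count-true+false side k =
    trans (sym (∑-distrib-+ (in-class true) (in-class false))) (sum-cong-≗ λ i → split (does (colour i ≟ k)) (side i))
    where
    in-class : Bool → Fin n → ℕ
    in-class s i = ⟦ does (colour i ≟ k) ∧ (side i == s) ⟧
    split : ∀ d b → ⟦ d ∧ (b == true) ⟧ + ⟦ d ∧ (b == false) ⟧ ≡ ⟦ d ⟧
    split false b     = refl
    split true  true  = refl
    split true  false = refl

  ∑-by-type : ∀ side (g : Fin q → Bool → ℕ) →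
    sum (λ i → g (colour i) (side i)) ≡ sum (λ k → sumBool (λ s → count side k s * g k s))
  ∑-by-type side g = begin
    sum (λ i → g (colour i) (side i))
      ≡⟨ sum-cong-≗ (λ i → sym (expand i)) ⟩
    sum (λ i → sum (λ k → sumBool (λ s → δ i k s * g k s)))
      ≡⟨ ∑-comm (λ i k → sumBool (λ s → δ i k s * g k s)) ⟩
    sum (λ k → sum (λ i → sumBool (λ s → δ i k s * g k s)))
      ≡⟨ sum-cong-≗ (λ k → ∑-distrib-+ (λ i → δ i k true * g k true) (λ i → δ i k false * g k false)) ⟩
    sum (λ k → sumBool (λ s → sum (λ i → δ i k s * g k s)))
      ≡⟨ sum-cong-≗ (λ k → cong₂ _+_ (factor k true) (factor k false)) ⟩
    sum (λ k → sumBool (λ s → count side k s * g k s)) ∎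
    where
    open ≡-Reasoning
    δ : Fin n → Fin q → Bool → ℕ
    δ i k s = ⟦ does (colour i ≟ k) ∧ (side i == s) ⟧
    expand : ∀ i → sum (λ k → sumBool (λ s → δ i k s * g k s)) ≡ g (colour i) (side i)
    expand i = trans (sum-cong-≗ (λ k → sumBool-δ (does (colour i ≟ k)) (side i) (g k)))
                     (sum-δ (colour i) (λ k → g k (side i)))
    factor : ∀ k s → sum (λ i → δ i k s * g k s) ≡ count side k s * g k s
    factor k s = sym (*-distribʳ-sum (g k s) (λ i → δ i k s))

  sum-classSize : sum classSize ≡ n
  sum-classSize = begin
    sum classSize
      ≡⟨ ∑-comm (λ k i → ⟦ does (colour i ≟ k) ⟧) ⟩
    sum (λ i → sum (λ k → ⟦ does (colour i ≟ k) ⟧))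
      ≡⟨ sum-cong-≗ (λ i → trans (sum-cong-≗ λ k → sym (*-identityʳ ⟦ does (colour i ≟ k) ⟧))
                                 (sum-δ (colour i) (λ _ → 1))) ⟩
    sum {n} (λ _ → 1)
      ≡⟨ sum-ones n ⟩
    n ∎
    where open ≡-Reasoning

  sizeTrue-by-colour : ∀ side → sizeTrue side ≡ sum (λ k → count side k true)
  sizeTrue-by-colour side = begin
    sizeTrue side
      ≡⟨ ∑≡sum n _ ⟩
    sum (λ i → ⟦ side i ⟧)
      ≡⟨ ∑-by-type side (λ _ s → ⟦ s ⟧) ⟩
    sum (λ k → count side k true * 1 + count side k false * 0)
      ≡⟨ sum-cong-≗ (λ k → cong₂ _+_ (*-identityʳ (count side k true)) (*-zeroʳ (count side k false))) ⟩
    sum (λ k → count side k true + 0)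
      ≡⟨ sum-cong-≗ (λ k → +-identityʳ (count side k true)) ⟩
    sum (λ k → count side k true) ∎
    where open ≡-Reasoning

fill : ∀ {n q} → (Fin n → Fin q) → (Fin q → ℕ) → Fin n → Bool
fill colour budget zero    = 0 <ᵇ budget (colour zero)
fill colour budget (suc i) = fill (colour ∘ suc) (updateAt budget (colour zero) pred) i

count-fill : ∀ {n q} (colour : Fin n → Fin q) budget k →
  count colour (fill colour budget) k true ≡ budget k ⊓ classSize colour k
count-fill {zero}  colour budget k = sym (⊓-zeroʳ (budget k))
count-fill {suc n} colour budget k =
  first-vertex (colour zero) (count-fill (colour ∘ suc) (updateAt budget (colour zero) pred) k)
  where
  take-one : ∀ b s → ⟦ (0 <ᵇ b) == true ⟧ + (pred b ⊓ s) ≡ b ⊓ suc s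
  take-one zero    s = refl
  take-one (suc b) s = refl
  first-vertex : ∀ x {r s} → r ≡ updateAt budget x pred k ⊓ s →
    ⟦ does (x ≟ k) ∧ ((0 <ᵇ budget x) == true) ⟧ + r ≡ budget k ⊓ (⟦ does (x ≟ k) ⟧ + s)
  first-vertex x {s = s} r≡ with x ≟ k
  ... | yes refl = trans (cong (_ +_) (trans r≡ (cong (_⊓ s) (updateAt-updates x budget))))
                         (take-one (budget x) s)
  ... | no x≢k   = trans r≡ (cong (_⊓ s) (updateAt-minimal k x budget (x≢k ∘ sym)))

fill-counts : ∀ {n q} (colour : Fin n → Fin q) budget k {y} → budget k + y ≡ classSize colour k →
  count colour (fill colour budget) k true ≡ budget k × count colour (fill colour budget) k false ≡ y
fill-counts {n} colour budget k {y} x+y≡ = in-A , in-B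
  where
  side : Fin n → Bool
  side = fill colour budget
  in-A : count colour side k true ≡ budget k
  in-A = trans (count-fill colour budget k) (m≤n⇒m⊓n≡m (≤-by-excess y (sym x+y≡)))
  in-B : count colour side k false ≡ y
  in-B = +-cancelˡ-≡ (budget k) (count colour side k false) y
    (trans (cong (_+ count colour side k false) (sym in-A))
           (trans (count-true+false colour side k) (sym x+y≡)))

-- Same-side pairs of distinct colours

<-exclusive : ∀ a b → ⟦ does (a <? b) ⟧ + ⟦ does (b <? a) ⟧ ≤ 1
<-exclusive zero    zero    = z≤n
<-exclusive zero    (suc b) = ≤-refl
<-exclusive (suc a) zero    = ≤-refl
<-exclusive (suc a) (suc b) = <-exclusive a b

sum-ordered-pairs : ∀ {n} (f : Fin n → Fin n → ℕ) → (∀ i j → f i j ≡ f j i) →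
  2 * sum (λ i → sum (λ j → ⟦ does (toℕ i <? toℕ j) ⟧ * f i j)) ≤ sum (λ i → sum (λ j → f i j))
sum-ordered-pairs {n} f f-sym = begin
  2 * upper
    ≡⟨ cong (upper +_) (+-identityʳ upper) ⟩
  upper + upper
    ≡⟨ cong (upper +_) lower≡upper ⟨
  upper + lower
    ≡⟨ sum²-distrib-+ ⟨
  sum (λ i → sum (λ j → ordered i j * f i j + ordered j i * f i j))
    ≤⟨ sum-mono-≤ (λ i → sum-mono-≤ (λ j → at-most-once i j)) ⟩
  sum (λ i → sum (λ j → f i j)) ∎
  where
  open ≤-Reasoning
  ordered : Fin n → Fin n → ℕ
  ordered i j = ⟦ does (toℕ i <? toℕ j) ⟧
  upper lower : ℕ
  upper = sum (λ i → sum (λ j → ordered i j * f i j))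
  lower = sum (λ i → sum (λ j → ordered j i * f i j))
  lower≡upper : lower ≡ upper
  lower≡upper = trans (∑-comm (λ i j → ordered j i * f i j))
    (sum-cong-≗ λ j → sum-cong-≗ λ i → cong (ordered j i *_) (f-sym i j))
  sum²-distrib-+ : sum (λ i → sum (λ j → ordered i j * f i j + ordered j i * f i j)) ≡ upper + lower
  sum²-distrib-+ =
    trans (sum-cong-≗ λ i → ∑-distrib-+ (λ j → ordered i j * f i j) (λ j → ordered j i * f i j))
          (∑-distrib-+ (λ i → sum (λ j → ordered i j * f i j)) (λ i → sum (λ j → ordered j i * f i j)))
  at-most-once : ∀ i j → ordered i j * f i j + ordered j i * f i j ≤ f i j
  at-most-once i j = begin
    ordered i j * f i j + ordered j i * f i j ≡⟨ *-distribʳ-+ (f i j) (ordered i j) (ordered j i) ⟨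
    (ordered i j + ordered j i) * f i j       ≤⟨ *-monoˡ-≤ (f i j) (<-exclusive (toℕ i) (toℕ j)) ⟩
    1 * f i j                                 ≡⟨ *-identityˡ (f i j) ⟩
    f i j                                     ∎

does-≟-sym : ∀ {q} (x y : Fin q) → does (x ≟ y) ≡ does (y ≟ x)
does-≟-sym x y with x ≟ y
... | yes x≡y = sym (dec-true (y ≟ x) (sym x≡y))
... | no x≢y  = sym (dec-false (y ≟ x) (x≢y ∘ sym))

==-sym : ∀ a b → (a == b) ≡ (b == a)
==-sym true  true  = refl
==-sym true  false = refl
==-sym false true  = refl
==-sym false false = refl

otherColours : ∀ {q} → (Fin q → ℕ) → Fin q → ℕ
otherColours x k = sum (λ l → ⟦ not (does (k ≟ l)) ⟧ * x l)

sum-otherColours³ : (x : Fin 3 → ℕ) → sum (λ k → x k * otherColours x k) ≡ 2 * e₂ (x 0F) (x 1F) (x 2F)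
sum-otherColours³ x = expanded (x 0F) (x 1F) (x 2F)
  where
  expanded : ∀ a b c →
    a * (0 * a + (1 * b + (1 * c + 0))) + (b * (1 * a + (0 * b + (1 * c + 0))) + (c * (1 * a + (1 * b + (0 * c + 0))) + 0))
    ≡ 2 * (a * b + a * c + b * c)
  expanded = solve-∀

crossPairs : ∀ {n} → (Fin n → Fin 3) → (Fin n → Bool) → ℕ
crossPairs colour side =
  sumBool (λ s → e₂ (count colour side 0F s) (count colour side 1F s) (count colour side 2F s))

module _ {n q : ℕ} (colour : Fin n → Fin q) (side : Fin n → Bool) where

  sameSideCross : Fin n → Fin n → ℕ
  sameSideCross i j = ⟦ not (does (colour i ≟ colour j)) ∧ (side i == side j) ⟧

  sameSideCross-sym : ∀ i j → sameSideCross i j ≡ sameSideCross j i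
  sameSideCross-sym i j =
    cong₂ (λ d e → ⟦ not d ∧ e ⟧) (does-≟-sym (colour i) (colour j)) (==-sym (side i) (side j))

  sum-sameSideCross : ∀ i → sum (sameSideCross i) ≡ otherColours (λ l → count colour side l (side i)) (colour i)
  sum-sameSideCross i = trans (∑-by-type colour side crosses-i) (sum-cong-≗ λ l →
    trans (cong₂ _+_ (*-comm (count colour side l true) (crosses-i l true))
                     (*-comm (count colour side l false) (crosses-i l false)))
          (sumBool-δ (not (does (colour i ≟ l))) (side i) (count colour side l)))
    where
    crosses-i : Fin q → Bool → ℕ
    crosses-i l t = ⟦ not (does (colour i ≟ l)) ∧ (side i == t) ⟧

sum²-sameSideCross : ∀ {n} (colour : Fin n → Fin 3) side →
  sum (λ i → sum (sameSideCross colour side i)) ≡ 2 * crossPairs colour side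
sum²-sameSideCross colour side = begin
  sum (λ i → sum (sameSideCross colour side i))
    ≡⟨ sum-cong-≗ (sum-sameSideCross colour side) ⟩
  sum (λ i → otherColours (λ l → N l (side i)) (colour i))
    ≡⟨ ∑-by-type colour side (λ k s → otherColours (λ l → N l s) k) ⟩
  sum (λ k → sumBool (λ s → N k s * otherColours (λ l → N l s) k))
    ≡⟨ ∑-distrib-+ (λ k → N k true * otherColours (λ l → N l true) k)
                   (λ k → N k false * otherColours (λ l → N l false) k) ⟩
  sumBool (λ s → sum (λ k → N k s * otherColours (λ l → N l s) k))
    ≡⟨ cong₂ _+_ (sum-otherColours³ (λ l → N l true)) (sum-otherColours³ (λ l → N l false)) ⟩
  sumBool (λ s → 2 * e₂ (N 0F s) (N 1F s) (N 2F s))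
    ≡⟨ *-distribˡ-+ 2 (e₂ (N 0F true) (N 1F true) (N 2F true))
                      (e₂ (N 0F false) (N 1F false) (N 2F false)) ⟨
  2 * crossPairs colour side ∎
  where
  open ≡-Reasoning
  N : Fin 3 → Bool → ℕ
  N = count colour side

inducedEdges≤crossPairs : ∀ {n} (G : Graph n) (colour : Fin n → Fin 3) →
  (∀ i j → Adj G i j ≡ true → colour i ≢ colour j) →
  ∀ side → inducedEdges G side ≤ crossPairs colour side
inducedEdges≤crossPairs {n} G colour proper side = *-cancelˡ-≤ 2 (begin
  2 * inducedEdges G side
    ≡⟨ cong (2 *_) (∑²≡sum² n (λ i j → ⟦ does (toℕ i <? toℕ j) ∧ (Adj G i j ∧ (side i == side j)) ⟧)) ⟩
  2 * sum (λ i → sum (λ j → ⟦ does (toℕ i <? toℕ j) ∧ (Adj G i j ∧ (side i == side j)) ⟧))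
    ≤⟨ *-monoʳ-≤ 2 (sum-mono-≤ λ i → sum-mono-≤ λ j →
         edge≤ (does (toℕ i <? toℕ j)) (Adj G i j) (proper-does i j)) ⟩
  2 * sum (λ i → sum (λ j → ⟦ does (toℕ i <? toℕ j) ⟧ * sameSideCross colour side i j))
    ≤⟨ sum-ordered-pairs (sameSideCross colour side) (sameSideCross-sym colour side) ⟩
  sum (λ i → sum (sameSideCross colour side i))
    ≡⟨ sum²-sameSideCross colour side ⟩
  2 * crossPairs colour side ∎)
  where
  open ≤-Reasoning
  proper-does : ∀ i j → Adj G i j ≡ true → does (colour i ≟ colour j) ≡ false
  proper-does i j adj = dec-false (colour i ≟ colour j) (proper i j adj)
  edge≤ : ∀ o adj {d e} → (adj ≡ true → d ≡ false) → ⟦ o ∧ (adj ∧ e) ⟧ ≤ ⟦ o ⟧ * ⟦ not d ∧ e ⟧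
  edge≤ false _                   _       = z≤n
  edge≤ true  false               _       = z≤n
  edge≤ true  true  {e = false}   _       = z≤n
  edge≤ true  true  {e = true}    d≡false rewrite d≡false refl = ≤-refl

realiseSplit : ∀ {n m} (colour : Fin n → Fin 3) →
  BalancedSplit m (classSize colour 0F) (classSize colour 1F) (classSize colour 2F) →
  Σ (Fin n → Bool) λ side → (sizeTrue side ≡ m) × (9 * crossPairs colour side ≤ (m + m) * (m + m))
realiseSplit {n} {m} colour split =
  side , size , subst (λ t → 9 * t ≤ (m + m) * (m + m)) (sym cross) bound
  where
  open BalancedSplit split
  budget : Fin 3 → ℕ
  budget = lookup (xa ∷ xb ∷ xc ∷ [])
  side : Fin n → Bool
  side = fill colour budget
  N : Fin 3 → Bool → ℕ
  N = count colour side
  a-counts : N 0F true ≡ xa × N 0F false ≡ ya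
  a-counts = fill-counts colour budget 0F a-split
  b-counts : N 1F true ≡ xb × N 1F false ≡ yb
  b-counts = fill-counts colour budget 1F b-split
  c-counts : N 2F true ≡ xc × N 2F false ≡ yc
  c-counts = fill-counts colour budget 2F c-split
  size : sizeTrue side ≡ m
  size = begin
    sizeTrue side                      ≡⟨ sizeTrue-by-colour colour side ⟩
    sum (λ k → N k true)               ≡⟨ sum³ (λ k → N k true) ⟩
    N 0F true + N 1F true + N 2F true  ≡⟨ cong₂ _+_ (cong₂ _+_ (proj₁ a-counts) (proj₁ b-counts))
                                                    (proj₁ c-counts) ⟩
    xa + xb + xc                       ≡⟨ half ⟩
    m                                  ∎
    where open ≡-Reasoning
  cross : crossPairs colour side ≡ e₂ xa xb xc + e₂ ya yb yc
  cross rewrite proj₁ a-counts | proj₂ a-counts | proj₁ b-counts | proj₂ b-counts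
              | proj₁ c-counts | proj₂ c-counts = refl

proposition2p5 : (m : ℕ) → (G : Graph (2 * m)) → ThreePartite G →
    Σ (Fin (2 * m) → Bool) λ side →
      (sizeTrue side ≡ m) × (9 * inducedEdges G side ≤ (2 * m) * (2 * m))
proposition2p5 m G (colour , proper) =
  map₂ (λ {side} → map₂ (from-crossPairs side)) (realiseSplit colour (balancedSplit class-sizes))
  where
  m+m≡2*m : m + m ≡ 2 * m
  m+m≡2*m = cong (m +_) (sym (+-identityʳ m))
  class-sizes : classSize colour 0F + classSize colour 1F + classSize colour 2F ≡ m + m
  class-sizes = trans (sym (sum³ (classSize colour))) (trans (sum-classSize colour) (sym m+m≡2*m))
  from-crossPairs : ∀ side → 9 * crossPairs colour side ≤ (m + m) * (m + m) →
    9 * inducedEdges G side ≤ (2 * m) * (2 * m)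
  from-crossPairs side bound = ≤-trans (*-monoʳ-≤ 9 (inducedEdges≤crossPairs G colour proper side))
    (subst (λ k → 9 * crossPairs colour side ≤ k * k) m+m≡2*m bound)
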